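{- Let $d\in\{2,7,11,19,43,67,163\}$, $K=\mathbb{Q}(\sqrt{ -d})$, let $L_{\mathfrak{o}}\subset\mathbb{R}^2$ be $\mathcal{O}_K$ under the identification $\mathbb{C}\cong\mathbb{R}^2$, $a+bi\mapsto(a,b)$, let $P_1(x,y)=(x^2-y^2)/2$, and write $\Theta_{L_{\mathfrak{o}},P_1}(q)=\sum_{v\in L_{\mathfrak{o}}}P_1(v)q^{(v,v)}=\sum_{m\ge1}b(m)q^m$. Let $p$ be a prime with $(d_K/p)=1$. Then $b(p)\neq 0$. Moreover, if $p\neq d$ then $b(p)\neq\pm p$.
   Context: $(\cdot,\cdot)$ is the standard inner product on $\mathbb{R}^2$. $d_K$ is the discriminant of $K$ ($d_K=-8$ for $d=2$, $d_K=-d$ otherwise), and $(d_K/p)$ is the Kronecker symbol (for $p=2$: equal to $1$ iff $d_K\equiv1\pmod8$). -}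

module Defs where

open import Data.Nat as ℕ using (ℕ; zero; suc)
open import Data.Integer as ℤ using (ℤ; +_; -[1+_])
open import Data.Rational as ℚ using (ℚ; 0ℚ)
open import Data.List using (List; []; _∷_; map; foldr; filter; upTo; concatMap)
open import Data.Product using (_×_; _,_; ∃)
open import Data.Empty using (⊥)
open import Relation.Nullary using (¬_)
open import Relation.Binary.PropositionalEquality using (_≡_)
open import Data.Integer.Divisibility using () renaming (_∣_ to _∣ℤ_)

-- The admissible values of d (class number one, O_K has an integral power basis).
admissibleD : List ℕ
admissibleD = 2 ∷ 7 ∷ 11 ∷ 19 ∷ 43 ∷ 67 ∷ 163 ∷ []

disc : ℕ → ℤ
disc 2 = -[1+ 7 ]
disc d = ℤ.- (+ d)

-- Kronecker symbol (d_K / p) equals 1, for a prime p: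
--  * p = 2 : d_K ≡ 1 (mod 8)
--  * p odd : d_K is a nonzero square modulo p (Legendre symbol = 1)
KroneckerOne : ℤ → ℕ → Set
KroneckerOne dK 2 = (+ 8) ∣ℤ (dK ℤ.- + 1)
KroneckerOne dK p = ¬ ((+ p) ∣ℤ dK) × ∃ λ (x : ℤ) → (+ p) ∣ℤ (x ℤ.* x ℤ.- dK)

-- Elements of O_K are written m + n ω with (m , n) ∈ ℤ², where
--   ω = sqrt(-2) = i√2                  if d = 2,
--   ω = (1 + sqrt(-d))/2 = 1/2 + i√d/2  otherwise (d ≡ 3 mod 4).
-- Under C ≅ R², a+bi ↦ (a,b), the vector v is
--   (m , n√2)              if d = 2,
--   (m + n/2 , n√d/2)      otherwise.
-- innerSq d m n = (v , v)  (an integer)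
innerSq : ℕ → ℤ → ℤ → ℤ
innerSq 2 m n = m ℤ.* m ℤ.+ (+ 2) ℤ.* (n ℤ.* n)
innerSq d m n = m ℤ.* m ℤ.+ m ℤ.* n ℤ.+ (+ ((suc d) ℕ./ 4)) ℤ.* (n ℤ.* n)

-- P1 d m n = P_1(v) = (x² - y²)/2 where (x , y) = v:
--   d = 2 :  (m² - 2n²)/2
--   else  :  ((m + n/2)² - d n²/4)/2 = ((2m+n)² - d n²)/8
P1 : ℕ → ℤ → ℤ → ℚ
P1 2 m n = (m ℤ.* m ℤ.- (+ 2) ℤ.* (n ℤ.* n)) ℚ./ 2
P1 d m n = ((+ 2 ℤ.* m ℤ.+ n) ℤ.* (+ 2 ℤ.* m ℤ.+ n) ℤ.- (+ d) ℤ.* (n ℤ.* n)) ℚ./ 8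

symRange : ℕ → List ℤ
symRange N = map (λ k → (+ k) ℤ.- (+ N)) (upTo (suc (N ℕ.+ N)))

box : ℕ → List (ℤ × ℤ)
box N = concatMap (λ m → map (λ n → (m , n)) (symRange N)) (symRange N)

sumℚ : List ℚ → ℚ
sumℚ = foldr ℚ._+_ 0ℚ

-- For N ≥ 1 every v with (v,v) = N has |m|,|n| ≤ N, so summing over the box is
-- exactly the sum over all lattice vectors of squared length N.
thetaCoeff : ℕ → ℕ → ℚ
thetaCoeff d N = sumℚ (map (λ { (m , n) → P1 d m n })
                     (filter (λ { (m , n) → innerSq d m n ℤ.≟ + N }) (box N)))

module Submission where

-- Write O_K = ℤ[ω] with ω² - e ω + c = 0, so that the squared length of m + n ω is the norm form
-- N(m, n) = m² + e m n + c n², of discriminant e² - 4c = d_K = -D.  If (d_K / p) = 1 then -D is a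
-- square modulo p; this gives a binary quadratic form of discriminant -D representing p, and since
-- every reduced form of discriminant -D is the principal one (a finite check), N represents p.
-- If N(v) = N(w) = p, then p divides Im (v w̄) Im (v w) = (Im ω)² (n₁² N(w) - n₂² N(v)), and
-- comparing with |v w̄|² = p² forces one of the two imaginary parts to vanish: the representations
-- of p are exactly v, -v, v̄, -v̄, four distinct vectors when p ∤ D.  Writing X = 2m + e n, the
-- coefficient is therefore b(p) = 4 P₁(v) = (X² - D n²)/2 = X² - 2p, since X² + D n² = 4p.
-- It is 0, -p or p only if X² = 2p, p or 3p, i.e. p ∣ 2, p ∣ 1, or p = 3 and D n² = 3, none of
-- which can happen.  The only admissible case with p = 2 is d = 7, where b(2) = -3.

open import Defs
open import Data.Nat using (ℕ)
open import Data.Nat.Primality using (Prime)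
open import Data.Integer using (+_; -_)
open import Data.Rational using (ℚ; 0ℚ; _/_)
open import Data.List.Membership.Propositional using (_∈_)
open import Data.Product using (_×_)
open import Relation.Binary.PropositionalEquality using (_≡_; _≢_)

open import Relation.Binary.PropositionalEquality
open import Data.Nat as ℕ using (ℕ; zero; suc; _≤_; _<_; z≤n; s≤s; _≤?_; _<?_; _≟_)
import Data.Nat.Properties as ℕₚ
open import Data.Nat.Properties using (allUpTo?)
open import Data.Nat.Divisibility using (_∣_; _∣?_; divides; ∣1⇒≡1)
open import Data.Nat.Primality
  using (Irreducible; euclidsLemma; prime⇒nonZero; prime⇒nonTrivial; prime⇒irreducible;
         ¬prime[0]; ¬prime[1]; irreducible[2]; irreducible?)
open import Data.Nat.Tactic.RingSolver using () renaming (solve-∀ to ℕ-solve-∀)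
open import Data.Integer as ℤ using (ℤ; -[1+_]; +[1+_]; ∣_∣; _+_; _*_; _-_)
import Data.Integer.Properties as ℤₚ
import Data.Integer.Divisibility as ℤᵘ
import Data.Integer.Divisibility.Signed as ℤˢ
open import Data.Integer.DivMod using (_/ℕ_; _%ℕ_; a≡a%ℕn+[a/ℕn]*n; n%ℕd<d)
open import Data.Integer.Tactic.RingSolver using (solve-∀)
open import Data.Rational as ℚ using ()
import Data.Rational.Properties as ℚₚ
open import Data.Rational.Solver using (module +-*-Solver)
open import Data.Rational.Unnormalised as ℚᵘ using (mkℚᵘ; *≡*)
import Data.Rational.Unnormalised.Properties as ℚᵘₚ
open import Data.Empty using (⊥-elim)
open import Data.Sum using (_⊎_; inj₁; inj₂; [_,_]′)
open import Data.Product using (_,_; proj₁; proj₂; ∃; ∃₂; uncurry)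
open import Data.List using (List; []; _∷_; map; filter; concatMap; cartesianProduct; _++_)
open import Data.List.Membership.Propositional.Properties
  using (∈-filter⁺; ∈-filter⁻; ∈-map⁺; ∈-upTo⁺; ∈-cartesianProduct⁺)
open import Data.List.Membership.Propositional.Properties.WithK using (unique∧set⇒bag)
open import Data.List.Relation.Binary.BagAndSetEquality using (∼bag⇒↭)
open import Data.List.Relation.Binary.Permutation.Propositional using (_↭_; ↭⇒↭ₛ)
import Data.List.Relation.Binary.Permutation.Propositional.Properties as ↭
open import Data.List.Relation.Binary.Permutation.Setoid.Properties (setoid ℚ) using (foldr-commMonoid)
open import Data.List.Relation.Unary.All using (_∷_; [])
open import Data.List.Relation.Unary.AllPairs using (_∷_; [])
open import Data.List.Relation.Unary.Any using (here; there)
open import Data.List.Relation.Unary.Unique.Propositional using (Unique)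
import Data.List.Relation.Unary.Unique.Propositional.Properties as Unique
open import Function using (_∘_)
open import Function.Bundles using (mk⇔)
open import Relation.Binary.Definitions using (tri<; tri≈; tri>)
open import Relation.Nullary using (¬_; Dec; yes; no)
open import Relation.Nullary.Decidable using (from-yes; from-no; _→-dec_; _×-dec_)
open import Relation.Unary using (Decidable)

prime≥2 : ∀ {p} → Prime p → 2 ≤ p
prime≥2 {p} pp = ℕ.nonTrivial⇒n>1 p {{prime⇒nonTrivial pp}}

prime∤1 : ∀ {p} → Prime p → ¬ p ∣ 1
prime∤1 pp p∣1 = ¬prime[1] (subst Prime (∣1⇒≡1 p∣1) pp)

prime∣irreducible⇒≡ : ∀ {p q} → Prime p → Irreducible q → p ∣ q → p ≡ q
prime∣irreducible⇒≡ pp irr p∣q with irr p∣q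
... | inj₁ refl = ⊥-elim (¬prime[1] pp)
... | inj₂ p≡q  = p≡q

prime∣4⇒≡2 : ∀ {p} → Prime p → p ∣ 4 → p ≡ 2
prime∣4⇒≡2 pp p∣4 = [ p∣2⇒p≡2 , p∣2⇒p≡2 ]′ (euclidsLemma 2 2 pp p∣4)
  where p∣2⇒p≡2 = prime∣irreducible⇒≡ pp irreducible[2]

prime∣3⇒≡3 : ∀ {p} → Prime p → p ∣ 3 → p ≡ 3
prime∣3⇒≡3 pp = prime∣irreducible⇒≡ pp (from-yes (irreducible? 3))

prime≢2⇒odd : ∀ {p} → Prime p → p ≢ 2 → ∃ λ j → p ≡ suc (j ℕ.+ j)
prime≢2⇒odd {p} pp p≢2 with half p
  where
  half : ∀ n → ∃ λ j → n ≡ j ℕ.+ j ⊎ n ≡ suc (j ℕ.+ j)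
  half zero = 0 , inj₁ refl
  half (suc n) with half n
  ... | j , inj₁ refl = j , inj₂ refl
  ... | j , inj₂ refl = suc j , inj₁ (cong suc (sym (ℕₚ.+-suc j j)))
... | j , inj₂ p≡2j+1 = j , p≡2j+1
... | j , inj₁ refl with prime⇒irreducible pp (divides j (trans (cong (j ℕ.+_) (sym (ℕₚ.+-identityʳ j))) (ℕₚ.*-comm 2 j)))
...   | inj₁ ()
...   | inj₂ 2≡p = ⊥-elim (p≢2 (sym 2≡p))

n*n≡m*m⇒n≡m : ∀ {n m} → n ℕ.* n ≡ m ℕ.* m → n ≡ m
n*n≡m*m⇒n≡m {n} {m} eq with ℕₚ.<-cmp n m
... | tri< n<m _ _ = ⊥-elim (ℕₚ.<⇒≢ (ℕₚ.*-mono-< n<m n<m) eq)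
... | tri≈ _ n≡m _ = n≡m
... | tri> _ _ n>m = ⊥-elim (ℕₚ.<⇒≢ (ℕₚ.*-mono-< n>m n>m) (sym eq))

n*n≤m*m⇒n≤m : ∀ {n m} → n ℕ.* n ≤ m ℕ.* m → n ≤ m
n*n≤m*m⇒n≤m {n} {m} le with ℕₚ.≤-<-connex n m
... | inj₁ n≤m = n≤m
... | inj₂ m<n = ⊥-elim (ℕₚ.<⇒≱ (ℕₚ.*-mono-< m<n m<n) le)

5≤D⇒D*n²≢3 : ∀ {D} n → 5 ≤ D → D ℕ.* (n ℕ.* n) ≢ 3
5≤D⇒D*n²≢3 {D} zero    _   eq = ℕₚ.0≢1+n (trans (sym (ℕₚ.*-zeroʳ D)) eq)
5≤D⇒D*n²≢3 {D} (suc k) 5≤D eq =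
  from-no (5 ≤? 3) (ℕₚ.≤-trans 5≤D (ℕₚ.≤-trans (ℕₚ.m≤m*n D (suc k ℕ.* suc k)) (ℕₚ.≤-reflexive eq)))

n*n+D*[b*p]²≡4*p²⇒b≡0 : ∀ n b p D → 1 ≤ p → 5 ≤ D →
  n ℕ.* n ℕ.+ D ℕ.* ((b ℕ.* p) ℕ.* (b ℕ.* p)) ≡ 4 ℕ.* (p ℕ.* p) → b ≡ 0
n*n+D*[b*p]²≡4*p²⇒b≡0 n zero    p D _ _ _ = refl
n*n+D*[b*p]²≡4*p²⇒b≡0 n (suc b) p D 1≤p 5≤D eq = ⊥-elim (ℕₚ.<⇒≱ 5≤D D≤4)
  where
  instance
    p≢0 : ℕ.NonZero p
    p≢0 = ℕ.>-nonZero 1≤p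
    p²≢0 : ℕ.NonZero (p ℕ.* p)
    p²≢0 = ℕₚ.m*n≢0 p p
  p²≤[bp]² : p ℕ.* p ≤ (suc b ℕ.* p) ℕ.* (suc b ℕ.* p)
  p²≤[bp]² = ℕₚ.*-mono-≤ (ℕₚ.m≤n*m p (suc b)) (ℕₚ.m≤n*m p (suc b))
  D≤4 : D ≤ 4
  D≤4 = ℕₚ.*-cancelʳ-≤ D 4 (p ℕ.* p) (ℕₚ.≤-trans (ℕₚ.*-monoʳ-≤ D p²≤[bp]²)
          (ℕₚ.≤-trans (ℕₚ.m≤n+m _ (n ℕ.* n)) (ℕₚ.≤-reflexive eq)))

D*n²≡4p⇒p∣D : ∀ {p} → Prime p → p ≢ 2 → ∀ D n → D ℕ.* (n ℕ.* n) ≡ 4 ℕ.* p → p ∣ D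
D*n²≡4p⇒p∣D {p} pp p≢2 D n Dn²≡4p with euclidsLemma D (n ℕ.* n) pp (divides 4 Dn²≡4p)
... | inj₁ p∣D  = p∣D
... | inj₂ p∣n² = ⊥-elim ([ p∤n , p∤n ]′ (euclidsLemma n n pp p∣n²))
  where
  instance _ = prime⇒nonZero pp
  rearrange : ∀ D w q → D ℕ.* w ℕ.* w ℕ.* q ℕ.* q ≡ D ℕ.* ((w ℕ.* q) ℕ.* (w ℕ.* q))
  rearrange = ℕ-solve-∀
  p∤n : ¬ p ∣ n
  p∤n (divides w refl) = p≢2 (prime∣4⇒≡2 pp (divides (D ℕ.* w ℕ.* w)
    (sym (ℕₚ.*-cancelʳ-≡ _ 4 p (trans (rearrange D w p) Dn²≡4p)))))

i*i≡∣i∣*∣i∣ : ∀ i → i * i ≡ + (∣ i ∣ ℕ.* ∣ i ∣)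
i*i≡∣i∣*∣i∣ (+ zero)  = refl
i*i≡∣i∣*∣i∣ +[1+ _ ] = refl
i*i≡∣i∣*∣i∣ -[1+ _ ] = refl

pos-quadratic : ∀ D i j → + (∣ i ∣ ℕ.* ∣ i ∣ ℕ.+ D ℕ.* (∣ j ∣ ℕ.* ∣ j ∣)) ≡ i * i + + D * (j * j)
pos-quadratic D i j = begin
  + (∣ i ∣ ℕ.* ∣ i ∣ ℕ.+ D ℕ.* (∣ j ∣ ℕ.* ∣ j ∣))      ≡⟨ ℤₚ.pos-+ (∣ i ∣ ℕ.* ∣ i ∣) (D ℕ.* (∣ j ∣ ℕ.* ∣ j ∣)) ⟩
  + (∣ i ∣ ℕ.* ∣ i ∣) + + (D ℕ.* (∣ j ∣ ℕ.* ∣ j ∣))   ≡⟨ cong (λ x → + (∣ i ∣ ℕ.* ∣ i ∣) + x) (ℤₚ.pos-* D _) ⟩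
  + (∣ i ∣ ℕ.* ∣ i ∣) + + D * + (∣ j ∣ ℕ.* ∣ j ∣)     ≡⟨ cong₂ (λ x y → x + + D * y) (i*i≡∣i∣*∣i∣ i) (i*i≡∣i∣*∣i∣ j) ⟨
  i * i + + D * (j * j)                              ∎
  where open ≡-Reasoning

D*j²≤K : ∀ D i j K → i * i + + D * (j * j) ≡ + K → D ℕ.* (∣ j ∣ ℕ.* ∣ j ∣) ≤ K
D*j²≤K D i j K eq = ℕₚ.≤-trans (ℕₚ.m≤n+m _ (∣ i ∣ ℕ.* ∣ i ∣))
                      (ℕₚ.≤-reflexive (ℤₚ.+-injective (trans (pos-quadratic D i j) eq)))

i*i≡+k*+p⇒p∣k : ∀ {p} → Prime p → ∀ i k → i * i ≡ + k * + p → p ∣ k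
i*i≡+k*+p⇒p∣k {p} pp i k eq =
  [ square-of-multiple , square-of-multiple ]′ (euclidsLemma ∣ i ∣ ∣ i ∣ pp (divides k ∣i∣²≡kp))
  where
  instance _ = prime⇒nonZero pp
  ∣i∣²≡kp : ∣ i ∣ ℕ.* ∣ i ∣ ≡ k ℕ.* p
  ∣i∣²≡kp = ℤₚ.+-injective (trans (sym (i*i≡∣i∣*∣i∣ i)) (trans eq (sym (ℤₚ.pos-* k p))))
  rearrange : ∀ w q → (w ℕ.* w ℕ.* q) ℕ.* q ≡ (w ℕ.* q) ℕ.* (w ℕ.* q)
  rearrange = ℕ-solve-∀
  square-of-multiple : p ∣ ∣ i ∣ → p ∣ k
  square-of-multiple (divides w ∣i∣≡wp) = divides (w ℕ.* w)
    (sym (ℕₚ.*-cancelʳ-≡ (w ℕ.* w ℕ.* p) k p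
      (trans (rearrange w p) (trans (cong (λ x → x ℕ.* x) (sym ∣i∣≡wp)) ∣i∣²≡kp))))

∣i∣≡∣j∣⇒i≡±j : ∀ i j → ∣ i ∣ ≡ ∣ j ∣ → i ≡ j ⊎ i ≡ - j
∣i∣≡∣j∣⇒i≡±j (+ _)     (+ _)     refl = inj₁ refl
∣i∣≡∣j∣⇒i≡±j (+ zero)  -[1+ _ ]  ()
∣i∣≡∣j∣⇒i≡±j +[1+ _ ]  -[1+ _ ]  refl = inj₂ refl
∣i∣≡∣j∣⇒i≡±j -[1+ _ ]  (+ zero)  ()
∣i∣≡∣j∣⇒i≡±j -[1+ _ ]  +[1+ _ ]  refl = inj₂ refl
∣i∣≡∣j∣⇒i≡±j -[1+ _ ]  -[1+ _ ]  refl = inj₁ refl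

i*i≡j*j⇒i≡±j : ∀ i j → i * i ≡ j * j → i ≡ j ⊎ i ≡ - j
i*i≡j*j⇒i≡±j i j eq = ∣i∣≡∣j∣⇒i≡±j i j (n*n≡m*m⇒n≡m
  (ℤₚ.+-injective (trans (sym (i*i≡∣i∣*∣i∣ i)) (trans eq (i*i≡∣i∣*∣i∣ j)))))

i≡-i⇒i≡0 : ∀ {i} → i ≡ - i → i ≡ + 0
i≡-i⇒i≡0 {+ zero}   _  = refl
i≡-i⇒i≡0 {+[1+ _ ]} ()
i≡-i⇒i≡0 { -[1+ _ ] } ()

m≡-[m+k]⇒2m+k≡0 : ∀ m k → m ≡ - (m + k) → + 2 * m + k ≡ + 0
m≡-[m+k]⇒2m+k≡0 m k eq = trans (double m k) (trans (cong (_+ (m + k)) eq) (ℤₚ.+-inverseˡ (m + k)))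
  where
  double : ∀ m k → + 2 * m + k ≡ m + (m + k)
  double = solve-∀

euclidsLemmaℤ : ∀ {p} → Prime p → ∀ i j → (+ p) ℤˢ.∣ (i * j) → (+ p) ℤˢ.∣ i ⊎ (+ p) ℤˢ.∣ j
euclidsLemmaℤ {p} pp i j p∣ij with euclidsLemma ∣ i ∣ ∣ j ∣ pp (subst (p ∣_) (ℤₚ.abs-* i j) (ℤˢ.∣⇒∣ᵤ p∣ij))
... | inj₁ p∣i = inj₁ (ℤˢ.∣ᵤ⇒∣ p∣i)
... | inj₂ p∣j = inj₂ (ℤˢ.∣ᵤ⇒∣ p∣j)

-- INLINE lets the reflective ring solver see through these definitions.
norm : ℤ → ℤ → ℤ → ℤ → ℤ
norm e c m n = m * m + e * m * n + c * (n * n)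
{-# INLINE norm #-}

-- Im ((m₁ + n₁ ω) (m₂ + n₂ ω̄)) = cross m₁ n₁ m₂ n₂ · Im ω.
cross : ℤ → ℤ → ℤ → ℤ → ℤ
cross m₁ n₁ m₂ n₂ = m₂ * n₁ - m₁ * n₂
{-# INLINE cross #-}

norm-neg : ∀ e c m n → norm e c (- m) (- n) ≡ norm e c m n
norm-neg = solve-∀

norm-conj : ∀ e c m n → norm e c (m + e * n) (- n) ≡ norm e c m n
norm-conj = solve-∀

four-norm : ∀ e c m n → (+ 2 * m + e * n) * (+ 2 * m + e * n) + (+ 4 * c - e * e) * (n * n) ≡ + 4 * norm e c m n
four-norm = solve-∀

four-c-norm : ∀ e c m n → (+ 2 * c * n + e * m) * (+ 2 * c * n + e * m) + (+ 4 * c - e * e) * (m * m) ≡ + 4 * c * norm e c m n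
four-c-norm = solve-∀

four-norm-product : ∀ e c m₁ n₁ m₂ n₂ →
  let A = + 2 * m₁ * m₂ + e * (m₁ * n₂ + m₂ * n₁) + + 2 * c * n₁ * n₂
      B = cross m₁ n₁ m₂ n₂
  in A * A + (+ 4 * c - e * e) * (B * B) ≡ + 4 * norm e c m₁ n₁ * norm e c m₂ n₂
four-norm-product = solve-∀

cross-conj-product : ∀ e c m₁ n₁ m₂ n₂ →
  cross m₁ n₁ m₂ n₂ * cross m₁ n₁ (m₂ + e * n₂) (- n₂) ≡ n₁ * n₁ * norm e c m₂ n₂ - n₂ * n₂ * norm e c m₁ n₁
cross-conj-product = solve-∀

module NormForm (E C D : ℕ) (4C≡E²+D : 4 ℕ.* C ≡ E ℕ.* E ℕ.+ D) where

  e c : ℤ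
  e = + E
  c = + C

  N : ℤ → ℤ → ℤ
  N = norm e c

  neg conj : ℤ × ℤ → ℤ × ℤ
  neg (m , n)  = (- m , - n)
  conj (m , n) = (m + e * n , - n)

  orbit : ℤ × ℤ → List (ℤ × ℤ)
  orbit v = v ∷ neg v ∷ conj v ∷ neg (conj v) ∷ []

  conj-involutive : ∀ v → conj (conj v) ≡ v
  conj-involutive (m , n) = cong₂ _,_ (cancel e m n) (ℤₚ.neg-involutive n)
    where
    cancel : ∀ e m n → m + e * n + e * (- n) ≡ m
    cancel = solve-∀

  conj-neg : ∀ v → conj (neg v) ≡ neg (conj v)
  conj-neg (m , n) = cong (_, - - n) (neg-distrib e m n)
    where
    neg-distrib : ∀ e m n → - m + e * (- n) ≡ - (m + e * n)
    neg-distrib = solve-∀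

  ∈orbit⇒norm≡ : ∀ {u v} → u ∈ orbit v → uncurry N u ≡ uncurry N v
  ∈orbit⇒norm≡ {v = m , n} (here refl)                         = refl
  ∈orbit⇒norm≡ {v = m , n} (there (here refl))                 = norm-neg e c m n
  ∈orbit⇒norm≡ {v = m , n} (there (there (here refl)))         = norm-conj e c m n
  ∈orbit⇒norm≡ {v = m , n} (there (there (there (here refl)))) = trans (norm-neg e c (m + e * n) (- n)) (norm-conj e c m n)

  4c-e²≡D : + 4 * c - e * e ≡ + D
  4c-e²≡D = begin
    + 4 * + C - + E * + E            ≡⟨ cong₂ _-_ (ℤₚ.pos-* 4 C) (ℤₚ.pos-* E E) ⟨
    + (4 ℕ.* C) - + (E ℕ.* E)        ≡⟨ cong (λ x → + x - + (E ℕ.* E)) 4C≡E²+D ⟩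
    + (E ℕ.* E ℕ.+ D) - + (E ℕ.* E)  ≡⟨ cong (_- + (E ℕ.* E)) (ℤₚ.pos-+ (E ℕ.* E) D) ⟩
    + (E ℕ.* E) + + D - + (E ℕ.* E)  ≡⟨ cancel (+ (E ℕ.* E)) (+ D) ⟩
    + D                              ∎
    where
    open ≡-Reasoning
    cancel : ∀ x y → x + y - x ≡ y
    cancel = solve-∀

  X²+Dn²≡4N : ∀ m n → (+ 2 * m + e * n) * (+ 2 * m + e * n) + + D * (n * n) ≡ + 4 * N m n
  X²+Dn²≡4N m n = trans (cong (λ x → (+ 2 * m + e * n) * (+ 2 * m + e * n) + x * (n * n)) (sym 4c-e²≡D))
                        (four-norm e c m n)

  module _ {p : ℕ} (pp : Prime p) where

    private instance
      p≢0 : ℕ.NonZero p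
      p≢0 = prime⇒nonZero pp

    norm≡p⇒n≢0 : ∀ m n → N m n ≡ + p → n ≢ + 0
    norm≡p⇒n≢0 m .(+ 0) N≡p refl =
      prime∤1 pp (i*i≡+k*+p⇒p∣k pp m 1 (trans (sym (norm-n≡0 e c m)) (trans N≡p (sym (ℤₚ.*-identityˡ (+ p))))))
      where
      norm-n≡0 : ∀ e c m → norm e c m (+ 0) ≡ m * m
      norm-n≡0 = solve-∀

    p∣cross⇒cross≡0 : 5 ≤ D → ∀ m₁ n₁ m₂ n₂ → N m₁ n₁ ≡ + p → N m₂ n₂ ≡ + p →
                      (+ p) ℤˢ.∣ cross m₁ n₁ m₂ n₂ → cross m₁ n₁ m₂ n₂ ≡ + 0
    p∣cross⇒cross≡0 5≤D m₁ n₁ m₂ n₂ N₁≡p N₂≡p (ℤˢ.divides β B≡βp) = trans B≡βp (cong (_* + p) β≡0)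
      where
      open ≡-Reasoning
      A = + 2 * m₁ * m₂ + e * (m₁ * n₂ + m₂ * n₁) + + 2 * c * n₁ * n₂
      B = cross m₁ n₁ m₂ n₂
      A²+D[βp]²≡4p² : + (∣ A ∣ ℕ.* ∣ A ∣ ℕ.+ D ℕ.* ((∣ β ∣ ℕ.* p) ℕ.* (∣ β ∣ ℕ.* p))) ≡ + (4 ℕ.* (p ℕ.* p))
      A²+D[βp]²≡4p² = begin
        + (∣ A ∣ ℕ.* ∣ A ∣ ℕ.+ D ℕ.* ((∣ β ∣ ℕ.* p) ℕ.* (∣ β ∣ ℕ.* p)))
          ≡⟨ cong (λ x → + (∣ A ∣ ℕ.* ∣ A ∣ ℕ.+ D ℕ.* (x ℕ.* x))) (ℤₚ.abs-* β (+ p)) ⟨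
        + (∣ A ∣ ℕ.* ∣ A ∣ ℕ.+ D ℕ.* (∣ β * + p ∣ ℕ.* ∣ β * + p ∣))
          ≡⟨ pos-quadratic D A (β * + p) ⟩
        A * A + + D * ((β * + p) * (β * + p))
          ≡⟨ cong₂ (λ x y → A * A + x * (y * y)) (sym 4c-e²≡D) (sym B≡βp) ⟩
        A * A + (+ 4 * c - e * e) * (B * B)
          ≡⟨ four-norm-product e c m₁ n₁ m₂ n₂ ⟩
        + 4 * N m₁ n₁ * N m₂ n₂
          ≡⟨ cong₂ (λ x y → + 4 * x * y) N₁≡p N₂≡p ⟩
        + 4 * + p * + p
          ≡⟨ trans (ℤₚ.*-assoc (+ 4) (+ p) (+ p)) (cong (+ 4 *_) (sym (ℤₚ.pos-* p p))) ⟩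
        + 4 * + (p ℕ.* p)
          ≡⟨ ℤₚ.pos-* 4 (p ℕ.* p) ⟨
        + (4 ℕ.* (p ℕ.* p)) ∎
      β≡0 : β ≡ + 0
      β≡0 = ℤₚ.∣i∣≡0⇒i≡0 (n*n+D*[b*p]²≡4*p²⇒b≡0 ∣ A ∣ ∣ β ∣ p D (ℕₚ.≤-trans (s≤s z≤n) (prime≥2 pp)) 5≤D
                            (ℤₚ.+-injective A²+D[βp]²≡4p²))

    cross≡0⇒≡± : ∀ m₁ n₁ m₂ n₂ → N m₁ n₁ ≡ + p → N m₂ n₂ ≡ + p → cross m₁ n₁ m₂ n₂ ≡ + 0 →
                 (m₂ , n₂) ≡ (m₁ , n₁) ⊎ (m₂ , n₂) ≡ neg (m₁ , n₁)
    cross≡0⇒≡± m₁ n₁ m₂ n₂ N₁≡p N₂≡p B≡0 =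
      [ (λ n₂≡n₁ → inj₁ (cong₂ _,_ (m₂≡ m₁ (cong (m₁ *_) n₂≡n₁)) n₂≡n₁))
      , (λ n₂≡-n₁ → inj₂ (cong₂ _,_ (m₂≡ (- m₁) (trans (cong (m₁ *_) n₂≡-n₁) (m*-n≡-m*n m₁ n₁))) n₂≡-n₁))
      ]′ (i*i≡j*j⇒i≡±j n₂ n₁ n₂²≡n₁²)
      where
      open ≡-Reasoning
      [n₁²-n₂²]p≡0 : (n₁ * n₁ - n₂ * n₂) * + p ≡ + 0
      [n₁²-n₂²]p≡0 = begin
        (n₁ * n₁ - n₂ * n₂) * + p                             ≡⟨ factor n₁ n₂ (+ p) ⟩
        n₁ * n₁ * + p - n₂ * n₂ * + p                         ≡⟨ cong₂ (λ x y → n₁ * n₁ * x - n₂ * n₂ * y) N₂≡p N₁≡p ⟨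
        n₁ * n₁ * N m₂ n₂ - n₂ * n₂ * N m₁ n₁                 ≡⟨ cross-conj-product e c m₁ n₁ m₂ n₂ ⟨
        cross m₁ n₁ m₂ n₂ * cross m₁ n₁ (m₂ + e * n₂) (- n₂)  ≡⟨ cong (_* cross m₁ n₁ (m₂ + e * n₂) (- n₂)) B≡0 ⟩
        + 0 * cross m₁ n₁ (m₂ + e * n₂) (- n₂)                ≡⟨ ℤₚ.*-zeroˡ (cross m₁ n₁ (m₂ + e * n₂) (- n₂)) ⟩
        + 0                                                   ∎
        where
        factor : ∀ a b q → (a * a - b * b) * q ≡ a * a * q - b * b * q
        factor = solve-∀
      n₂²≡n₁² : n₂ * n₂ ≡ n₁ * n₁
      n₂²≡n₁² = sym (ℤₚ.i-j≡0⇒i≡j (n₁ * n₁) (n₂ * n₂)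
                  (ℤₚ.*-cancelʳ-≡ (n₁ * n₁ - n₂ * n₂) (+ 0) (+ p) [n₁²-n₂²]p≡0))
      m*-n≡-m*n : ∀ m n → m * (- n) ≡ (- m) * n
      m*-n≡-m*n m n = trans (sym (ℤₚ.neg-distribʳ-* m n)) (ℤₚ.neg-distribˡ-* m n)
      m₂≡ : ∀ m → m₁ * n₂ ≡ m * n₁ → m₂ ≡ m
      m₂≡ m m₁n₂≡mn₁ = ℤₚ.*-cancelʳ-≡ m₂ m n₁ {{ℤ.≢-nonZero (norm≡p⇒n≢0 m₁ n₁ N₁≡p)}}
                         (trans (ℤₚ.i-j≡0⇒i≡j (m₂ * n₁) (m₁ * n₂) B≡0) m₁n₂≡mn₁)

    norm≡p⇒∈orbit : 5 ≤ D → ∀ m₁ n₁ m₂ n₂ → N m₁ n₁ ≡ + p → N m₂ n₂ ≡ + p → (m₂ , n₂) ∈ orbit (m₁ , n₁)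
    norm≡p⇒∈orbit 5≤D m₁ n₁ m₂ n₂ N₁≡p N₂≡p = [ via-cross , via-conj-cross ]′ (euclidsLemmaℤ pp B B̄ p∣BB̄)
      where
      B = cross m₁ n₁ m₂ n₂
      B̄ = cross m₁ n₁ (m₂ + e * n₂) (- n₂)
      p∣BB̄ : (+ p) ℤˢ.∣ (B * B̄)
      p∣BB̄ = ℤˢ.divides (n₁ * n₁ - n₂ * n₂) (begin
        B * B̄                                   ≡⟨ cross-conj-product e c m₁ n₁ m₂ n₂ ⟩
        n₁ * n₁ * N m₂ n₂ - n₂ * n₂ * N m₁ n₁   ≡⟨ cong₂ (λ x y → n₁ * n₁ * x - n₂ * n₂ * y) N₂≡p N₁≡p ⟩
        n₁ * n₁ * + p - n₂ * n₂ * + p           ≡⟨ factor n₁ n₂ (+ p) ⟩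
        (n₁ * n₁ - n₂ * n₂) * + p               ∎)
        where
        open ≡-Reasoning
        factor : ∀ a b q → a * a * q - b * b * q ≡ (a * a - b * b) * q
        factor = solve-∀
      via-cross : (+ p) ℤˢ.∣ B → (m₂ , n₂) ∈ orbit (m₁ , n₁)
      via-cross p∣B = [ here , there ∘ here ]′
        (cross≡0⇒≡± m₁ n₁ m₂ n₂ N₁≡p N₂≡p (p∣cross⇒cross≡0 5≤D m₁ n₁ m₂ n₂ N₁≡p N₂≡p p∣B))
      N̄₂≡p : N (m₂ + e * n₂) (- n₂) ≡ + p
      N̄₂≡p = trans (norm-conj e c m₂ n₂) N₂≡p
      w≡conj : ∀ {u} → conj (m₂ , n₂) ≡ u → (m₂ , n₂) ≡ conj u
      w≡conj w̄≡u = trans (sym (conj-involutive (m₂ , n₂))) (cong conj w̄≡u)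
      via-conj-cross : (+ p) ℤˢ.∣ B̄ → (m₂ , n₂) ∈ orbit (m₁ , n₁)
      via-conj-cross p∣B̄ =
        [ (λ w̄≡v → there (there (here (w≡conj w̄≡v))))
        , (λ w̄≡-v → there (there (there (here (trans (w≡conj w̄≡-v) (conj-neg (m₁ , n₁)))))))
        ]′ (cross≡0⇒≡± m₁ n₁ (m₂ + e * n₂) (- n₂) N₁≡p N̄₂≡p
              (p∣cross⇒cross≡0 5≤D m₁ n₁ (m₂ + e * n₂) (- n₂) N₁≡p N̄₂≡p p∣B̄))

    2m+en≢0 : p ≢ 2 → ¬ p ∣ D → ∀ m n → N m n ≡ + p → + 2 * m + e * n ≢ + 0
    2m+en≢0 p≢2 p∤D m n N≡p X≡0 = p∤D (D*n²≡4p⇒p∣D pp p≢2 D ∣ n ∣ (ℤₚ.+-injective (begin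
      + (D ℕ.* (∣ n ∣ ℕ.* ∣ n ∣))        ≡⟨ ℤₚ.pos-* D _ ⟩
      + D * + (∣ n ∣ ℕ.* ∣ n ∣)          ≡⟨ cong (+ D *_) (i*i≡∣i∣*∣i∣ n) ⟨
      + D * (n * n)                      ≡⟨ ℤₚ.+-identityˡ (+ D * (n * n)) ⟨
      + 0 * + 0 + + D * (n * n)          ≡⟨ cong (λ x → x * x + + D * (n * n)) X≡0 ⟨
      X * X + + D * (n * n)              ≡⟨ X²+Dn²≡4N m n ⟩
      + 4 * N m n                        ≡⟨ cong (+ 4 *_) N≡p ⟩
      + 4 * + p                          ≡⟨ ℤₚ.pos-* 4 p ⟨
      + (4 ℕ.* p)                        ∎)))
      where
      open ≡-Reasoning
      X = + 2 * m + e * n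

    orbit-unique : p ≢ 2 → ¬ p ∣ D → ∀ m n → N m n ≡ + p → Unique (orbit (m , n))
    orbit-unique p≢2 p∤D m n N≡p =
      (v≢-v ∷ v≢v̄ ∷ v≢-v̄ ∷ []) ∷ (-v≢v̄ ∷ -v≢-v̄ ∷ []) ∷ (v̄≢-v̄ ∷ []) ∷ [] ∷ []
      where
      n≢0 = norm≡p⇒n≢0 m n N≡p
      X≢0 = 2m+en≢0 p≢2 p∤D m n N≡p
      v≢-v : (m , n) ≢ neg (m , n)
      v≢-v eq = n≢0 (i≡-i⇒i≡0 (cong proj₂ eq))
      v≢v̄ : (m , n) ≢ conj (m , n)
      v≢v̄ eq = n≢0 (i≡-i⇒i≡0 (cong proj₂ eq))
      v≢-v̄ : (m , n) ≢ neg (conj (m , n))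
      v≢-v̄ eq = X≢0 (m≡-[m+k]⇒2m+k≡0 m (e * n) (cong proj₁ eq))
      -v≢v̄ : neg (m , n) ≢ conj (m , n)
      -v≢v̄ eq = X≢0 (m≡-[m+k]⇒2m+k≡0 m (e * n) (trans (sym (ℤₚ.neg-involutive m)) (cong (-_ ∘ proj₁) eq)))
      -v≢-v̄ : neg (m , n) ≢ neg (conj (m , n))
      -v≢-v̄ eq = n≢0 (i≡-i⇒i≡0 (ℤₚ.neg-injective (cong proj₂ eq)))
      v̄≢-v̄ : conj (m , n) ≢ neg (conj (m , n))
      v̄≢-v̄ eq = n≢0 (i≡-i⇒i≡0 (ℤₚ.neg-injective (cong proj₂ eq)))

    norm≡p⇒∣n∣≤p : 5 ≤ D → ∀ m n → N m n ≡ + p → ∣ n ∣ ≤ p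
    norm≡p⇒∣n∣≤p 5≤D m n N≡p =
      n*n≤m*m⇒n≤m (ℕₚ.*-cancelˡ-≤ D (ℕₚ.≤-trans (D*j²≤K D X n (4 ℕ.* p) X²+Dn²≡4p) 4p≤Dp²))
      where
      instance _ = ℕ.>-nonZero (ℕₚ.≤-trans (s≤s z≤n) 5≤D)
      X = + 2 * m + e * n
      X²+Dn²≡4p : X * X + + D * (n * n) ≡ + (4 ℕ.* p)
      X²+Dn²≡4p = trans (X²+Dn²≡4N m n) (trans (cong (+ 4 *_) N≡p) (sym (ℤₚ.pos-* 4 p)))
      4p≤Dp² : 4 ℕ.* p ≤ D ℕ.* (p ℕ.* p)
      4p≤Dp² = ℕₚ.*-mono-≤ (ℕₚ.≤-trans (ℕₚ.n≤1+n 4) 5≤D) (ℕₚ.m≤m*n p p)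

    norm≡p⇒∣m∣≤p : 5 ≤ D → E ≤ 1 → ∀ m n → N m n ≡ + p → ∣ m ∣ ≤ p
    norm≡p⇒∣m∣≤p 5≤D E≤1 m n N≡p =
      n*n≤m*m⇒n≤m (ℕₚ.*-cancelˡ-≤ D (ℕₚ.≤-trans (D*j²≤K D Y m (4 ℕ.* C ℕ.* p) Y²+Dm²≡4Cp) 4Cp≤Dp²))
      where
      1≤D = ℕₚ.≤-trans (s≤s z≤n) 5≤D
      instance _ = ℕ.>-nonZero 1≤D
      Y = + 2 * c * n + e * m
      Y²+Dm²≡4Cp : Y * Y + + D * (m * m) ≡ + (4 ℕ.* C ℕ.* p)
      Y²+Dm²≡4Cp = trans (cong (λ x → Y * Y + x * (m * m)) (sym 4c-e²≡D))
                     (trans (four-c-norm e c m n) (trans (cong (+ 4 * c *_) N≡p)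
                     (trans (cong (_* + p) (sym (ℤₚ.pos-* 4 C))) (sym (ℤₚ.pos-* (4 ℕ.* C) p)))))
      4C≤Dp : 4 ℕ.* C ≤ D ℕ.* p
      4C≤Dp = begin
        4 ℕ.* C        ≡⟨ 4C≡E²+D ⟩
        E ℕ.* E ℕ.+ D  ≤⟨ ℕₚ.+-monoˡ-≤ D (ℕₚ.≤-trans (ℕₚ.*-mono-≤ E≤1 E≤1) 1≤D) ⟩
        D ℕ.+ D        ≡⟨ cong (D ℕ.+_) (ℕₚ.+-identityʳ D) ⟨
        2 ℕ.* D        ≡⟨ ℕₚ.*-comm 2 D ⟩
        D ℕ.* 2        ≤⟨ ℕₚ.*-monoʳ-≤ D (prime≥2 pp) ⟩
        D ℕ.* p        ∎
        where open ℕₚ.≤-Reasoning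
      4Cp≤Dp² : 4 ℕ.* C ℕ.* p ≤ D ℕ.* (p ℕ.* p)
      4Cp≤Dp² = ℕₚ.≤-trans (ℕₚ.*-monoˡ-≤ p 4C≤Dp) (ℕₚ.≤-reflexive (ℕₚ.*-assoc D p p))

binaryForm : ℤ → ℤ → ℤ → ℤ → ℤ → ℤ
binaryForm a b c x y = a * (x * x) + b * (x * y) + c * (y * y)
{-# INLINE binaryForm #-}

center : ∀ a b → ∃ λ t → ∣ b + + 2 * + suc a * t ∣ ≤ suc a
center a b = go (b %ℕ K) (b /ℕ K) (a≡a%ℕn+[a/ℕn]*n b K) (n%ℕd<d b K)
  where
  K = suc a ℕ.+ suc a
  b+Kt : ∀ t → b + + 2 * + suc a * t ≡ b + + K * t
  b+Kt t = cong (λ z → b + z * t)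
             (trans (sym (ℤₚ.pos-* 2 (suc a))) (cong (λ n → + (suc a ℕ.+ n)) (ℕₚ.+-identityʳ (suc a))))
  go : ∀ r q → b ≡ + r + q * + K → r < K → ∃ λ t → ∣ b + + 2 * + suc a * t ∣ ≤ suc a
  go r q b≡r+qK r<K with r ≤? suc a
  ... | yes r≤a = - q , subst (_≤ suc a) (cong ∣_∣ (sym b-Kq≡r)) r≤a
    where
    cancel : ∀ r q k → r + q * k + k * (- q) ≡ r
    cancel = solve-∀
    b-Kq≡r : b + + 2 * + suc a * (- q) ≡ + r
    b-Kq≡r = trans (b+Kt (- q)) (trans (cong (_+ + K * (- q)) b≡r+qK) (cancel (+ r) q (+ K)))
  ... | no r≰a = - (q + + 1) , subst (_≤ suc a) (cong ∣_∣ (sym b-K[q+1]≡r-K)) ∣r-K∣≤a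
    where
    cancel : ∀ r q k → r + q * k + k * (- (q + + 1)) ≡ r - k
    cancel = solve-∀
    b-K[q+1]≡r-K : b + + 2 * + suc a * (- (q + + 1)) ≡ r ℤ.⊖ K
    b-K[q+1]≡r-K = trans (b+Kt (- (q + + 1))) (trans (cong (_+ + K * (- (q + + 1))) b≡r+qK)
                     (trans (cancel (+ r) q (+ K)) (ℤₚ.m-n≡m⊖n r K)))
    ∣r-K∣≤a : ∣ r ℤ.⊖ K ∣ ≤ suc a
    ∣r-K∣≤a = subst (_≤ suc a) (sym (ℤₚ.∣⊖∣-< r<K))
                (ℕₚ.≤-trans (ℕₚ.∸-monoʳ-≤ K (ℕₚ.<⇒≤ (ℕₚ.≰⇒> r≰a))) (ℕₚ.≤-reflexive (ℕₚ.m+n∸n≡m (suc a) (suc a))))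

module Reduction (D : ℕ) (1≤D : 1 ≤ D) (k : ℤ) where

  HasDisc : ℕ → ℤ → ℤ → Set
  HasDisc a b c = b * b + + D ≡ + 4 * + a * c

  Represents : ℕ → ℤ → ℤ → Set
  Represents a b c = ∃₂ λ x y → binaryForm (+ a) b c x y ≡ k

  translate-disc : ∀ a b c t → HasDisc a b c → HasDisc a (b + + 2 * + a * t) (+ a * (t * t) + b * t + c)
  translate-disc a b c t Δ = begin
    (b + + 2 * + a * t) * (b + + 2 * + a * t) + + D       ≡⟨ expand b (+ a) t (+ D) ⟩
    (b * b + + D) + + 4 * + a * (+ a * (t * t) + b * t)   ≡⟨ cong (_+ + 4 * + a * (+ a * (t * t) + b * t)) Δ ⟩
    + 4 * + a * c + + 4 * + a * (+ a * (t * t) + b * t)   ≡⟨ collect (+ a) c b t ⟩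
    + 4 * + a * (+ a * (t * t) + b * t + c)               ∎
    where
    open ≡-Reasoning
    expand : ∀ b a t D → (b + + 2 * a * t) * (b + + 2 * a * t) + D ≡ (b * b + D) + + 4 * a * (a * (t * t) + b * t)
    expand = solve-∀
    collect : ∀ a c b t → + 4 * a * c + + 4 * a * (a * (t * t) + b * t) ≡ + 4 * a * (a * (t * t) + b * t + c)
    collect = solve-∀

  translate-rep : ∀ a b c t → Represents a b c → Represents a (b + + 2 * + a * t) (+ a * (t * t) + b * t + c)
  translate-rep a b c t (x , y , f≡k) = x - t * y , y , trans (substitute (+ a) b c t x y) f≡k
    where
    substitute : ∀ a b c t x y →
      binaryForm a (b + + 2 * a * t) (a * (t * t) + b * t + c) (x - t * y) y ≡ binaryForm a b c x y
    substitute = solve-∀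

  swap-disc : ∀ a b C → HasDisc a b (+ C) → HasDisc C (- b) (+ a)
  swap-disc a b C Δ = trans (cong (_+ + D) (neg-square b)) (trans Δ (reorder (+ a) (+ C)))
    where
    neg-square : ∀ b → - b * - b ≡ b * b
    neg-square = solve-∀
    reorder : ∀ a c → + 4 * a * c ≡ + 4 * c * a
    reorder = solve-∀

  swap-rep : ∀ a b C → Represents a b (+ C) → Represents C (- b) (+ a)
  swap-rep a b C (x , y , f≡k) = - y , x , trans (substitute (+ a) b (+ C) x y) f≡k
    where
    substitute : ∀ a b c x y → binaryForm c (- b) a (- y) x ≡ binaryForm a b c x y
    substitute = solve-∀

  disc⇒c>0 : ∀ a b c → HasDisc (suc a) b c → ∃ λ C → c ≡ +[1+ C ]
  disc⇒c>0 a b (+ zero) Δ = ⊥-elim (ℕₚ.<⇒≢ 1≤D (sym (ℕₚ.m+n≡0⇒n≡0 (∣ b ∣ ℕ.* ∣ b ∣)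
    (ℤₚ.+-injective (trans (pos-b²+D b) (trans Δ (ℤₚ.*-zeroʳ (+ 4 * + suc a))))))))
    where
    pos-b²+D : ∀ b → + (∣ b ∣ ℕ.* ∣ b ∣ ℕ.+ D) ≡ b * b + + D
    pos-b²+D b = trans (ℤₚ.pos-+ (∣ b ∣ ℕ.* ∣ b ∣) D) (cong (_+ + D) (sym (i*i≡∣i∣*∣i∣ b)))
  disc⇒c>0 a b +[1+ C ] _ = C , refl
  disc⇒c>0 a b -[1+ C ] Δ = ⊥-elim (nonneg≢neg (trans (sym (ℤₚ.pos-+ (∣ b ∣ ℕ.* ∣ b ∣) D))
                                 (trans (cong (_+ + D) (sym (i*i≡∣i∣*∣i∣ b))) Δ)))
    where
    nonneg≢neg : ∀ {n} → + n ≢ + 4 * + suc a * -[1+ C ]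
    nonneg≢neg ()

  centered : ∀ a b c → HasDisc (suc a) b c → Represents (suc a) b c →
             ∃₂ λ b′ C → ∣ b′ ∣ ≤ suc a × HasDisc (suc a) b′ +[1+ C ] × Represents (suc a) b′ +[1+ C ]
  centered a b c Δ rep = let t , ∣b′∣≤a = center a b in translated t ∣b′∣≤a
    where
    translated : ∀ t → ∣ b + + 2 * + suc a * t ∣ ≤ suc a →
                 ∃₂ λ b′ C → ∣ b′ ∣ ≤ suc a × HasDisc (suc a) b′ +[1+ C ] × Represents (suc a) b′ +[1+ C ]
    translated t ∣b′∣≤a =
      let C , c′≡C+1 = disc⇒c>0 a b′ c′ Δ′ in
      b′ , C , ∣b′∣≤a , subst (HasDisc (suc a) b′) c′≡C+1 Δ′ , subst (Represents (suc a) b′) c′≡C+1 rep′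
      where
      b′ = b + + 2 * + suc a * t
      c′ = + suc a * (t * t) + b * t + c
      Δ′ = translate-disc (suc a) b c t Δ
      rep′ = translate-rep (suc a) b c t rep

  record Reduced : Set where
    field
      a C : ℕ
      b : ℤ
      1≤a : 1 ≤ a
      ∣b∣≤a : ∣ b ∣ ≤ a
      a≤C : a ≤ C
      hasDisc : HasDisc a b (+ C)
      represents : Represents a b (+ C)

  reduce : ∀ fuel a b c → a < fuel → HasDisc (suc a) b c → Represents (suc a) b c → Reduced
  reduce (suc fuel) a b c a<fuel Δ rep = compare (centered a b c Δ rep)
    where
    compare : (∃₂ λ b′ C → ∣ b′ ∣ ≤ suc a × HasDisc (suc a) b′ +[1+ C ] × Represents (suc a) b′ +[1+ C ]) → Reduced
    compare (b′ , C , ∣b′∣≤a , Δ′ , rep′) with suc a ≤? suc C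
    ... | yes a≤C = record { a = suc a ; C = suc C ; b = b′ ; 1≤a = s≤s z≤n ; ∣b∣≤a = ∣b′∣≤a ; a≤C = a≤C
                           ; hasDisc = Δ′ ; represents = rep′ }
    ... | no a≰C = reduce fuel C (- b′) (+ suc a) (ℕₚ.<-≤-trans (ℕₚ.≤-pred (ℕₚ.≰⇒> a≰C)) (ℕₚ.≤-pred a<fuel))
                     (swap-disc (suc a) b′ (suc C) Δ′) (swap-rep (suc a) b′ (suc C) rep′)

-- Here B = ∣b∣.  When D < 192 every reduced form of discriminant -D has a < 8 and C ≤ B² + D,
-- which makes ClassNumberOne decidable.
OnlyPrincipalReduced : ℕ → ℕ → ℕ → Set
OnlyPrincipalReduced D E a = ∀ {B} → B < suc a → ∀ {C} → C < suc (B ℕ.* B ℕ.+ D) →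
  1 ≤ a → a ≤ C → B ℕ.* B ℕ.+ D ≡ 4 ℕ.* a ℕ.* C → a ≡ 1 × B ≡ E

onlyPrincipalReduced? : ∀ D E a → Dec (OnlyPrincipalReduced D E a)
onlyPrincipalReduced? D E a = allUpTo? (λ B → allUpTo? (λ C →
  (1 ≤? a) →-dec (a ≤? C) →-dec (B ℕ.* B ℕ.+ D ≟ 4 ℕ.* a ℕ.* C) →-dec ((a ≟ 1) ×-dec (B ≟ E)))
  (suc (B ℕ.* B ℕ.+ D))) (suc a)

ClassNumberOne : ℕ → ℕ → Set
ClassNumberOne D E = ∀ {a} → a < 8 → OnlyPrincipalReduced D E a

classNumberOne? : ∀ D E → Dec (ClassNumberOne D E)
classNumberOne? D E = allUpTo? (onlyPrincipalReduced? D E) 8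

reduced⇒a<8 : ∀ D a B C → D < 192 → B ≤ a → a ≤ C → B ℕ.* B ℕ.+ D ≡ 4 ℕ.* a ℕ.* C → a < 8
reduced⇒a<8 D a B C D<192 B≤a a≤C eq with 8 ≤? a
... | no a≱8 = ℕₚ.≰⇒> a≱8
... | yes a≥8 = ⊥-elim (ℕₚ.<⇒≱ D<192 (ℕₚ.≤-trans 192≤3a² 3a²≤D))
  where
  4a²≤a²+D : 4 ℕ.* a ℕ.* a ≤ a ℕ.* a ℕ.+ D
  4a²≤a²+D = ℕₚ.≤-trans (ℕₚ.*-monoʳ-≤ (4 ℕ.* a) a≤C)
               (ℕₚ.≤-trans (ℕₚ.≤-reflexive (sym eq)) (ℕₚ.+-monoˡ-≤ D (ℕₚ.*-mono-≤ B≤a B≤a)))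
  split : ∀ a → a ℕ.* a ℕ.+ 3 ℕ.* (a ℕ.* a) ≡ 4 ℕ.* a ℕ.* a
  split = ℕ-solve-∀
  3a²≤D : 3 ℕ.* (a ℕ.* a) ≤ D
  3a²≤D = ℕₚ.+-cancelˡ-≤ (a ℕ.* a) _ _ (ℕₚ.≤-trans (ℕₚ.≤-reflexive (split a)) 4a²≤a²+D)
  192≤3a² : 192 ≤ 3 ℕ.* (a ℕ.* a)
  192≤3a² = ℕₚ.*-monoʳ-≤ 3 (ℕₚ.*-mono-≤ a≥8 a≥8)

module PrincipalForm (E C₀ D : ℕ) (4C₀≡E²+D : 4 ℕ.* C₀ ≡ E ℕ.* E ℕ.+ D) (1≤D : 1 ≤ D) (D<192 : D < 192)
                     (classNumberOne : ClassNumberOne D E) (k : ℤ) where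
  open Reduction D 1≤D k

  ±E-form⇒norm : ∀ b x y → b ≡ + E ⊎ b ≡ - + E → binaryForm (+ 1) b (+ C₀) x y ≡ k →
                 ∃₂ λ m n → norm (+ E) (+ C₀) m n ≡ k
  ±E-form⇒norm .(+ E) x y (inj₁ refl) f≡k = x , y , trans (same (+ E) (+ C₀) x y) f≡k
    where
    same : ∀ e c x y → norm e c x y ≡ binaryForm (+ 1) e c x y
    same = solve-∀
  ±E-form⇒norm .(- + E) x y (inj₂ refl) f≡k = x , - y , trans (flip (+ E) (+ C₀) x y) f≡k
    where
    flip : ∀ e c x y → norm e c x (- y) ≡ binaryForm (+ 1) (- e) c x y
    flip = solve-∀

  principal⇒norm : ∀ a b C x y → a ≡ 1 → ∣ b ∣ ≡ E → ∣ b ∣ ℕ.* ∣ b ∣ ℕ.+ D ≡ 4 ℕ.* a ℕ.* C →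
                   binaryForm (+ a) b (+ C) x y ≡ k → ∃₂ λ m n → norm (+ E) (+ C₀) m n ≡ k
  principal⇒norm .1 b C x y refl ∣b∣≡E Δ f≡k =
    ±E-form⇒norm b x y (∣i∣≡∣j∣⇒i≡±j b (+ E) ∣b∣≡E) (subst (λ C → binaryForm (+ 1) b (+ C) x y ≡ k) C≡C₀ f≡k)
    where
    C≡C₀ : C ≡ C₀
    C≡C₀ = ℕₚ.*-cancelˡ-≡ C C₀ 4 (begin
      4 ℕ.* C                ≡⟨ cong (ℕ._* C) (ℕₚ.*-identityʳ 4) ⟨
      4 ℕ.* 1 ℕ.* C          ≡⟨ Δ ⟨
      ∣ b ∣ ℕ.* ∣ b ∣ ℕ.+ D  ≡⟨ cong (λ n → n ℕ.* n ℕ.+ D) ∣b∣≡E ⟩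
      E ℕ.* E ℕ.+ D          ≡⟨ 4C₀≡E²+D ⟨
      4 ℕ.* C₀               ∎)
      where open ≡-Reasoning

  reduced⇒norm : Reduced → ∃₂ λ m n → norm (+ E) (+ C₀) m n ≡ k
  reduced⇒norm record { a = a ; C = C ; b = b ; 1≤a = 1≤a ; ∣b∣≤a = ∣b∣≤a ; a≤C = a≤C
                      ; hasDisc = Δ ; represents = x , y , f≡k } =
    principal⇒norm a b C x y (proj₁ a≡1×∣b∣≡E) (proj₂ a≡1×∣b∣≡E) Δℕ f≡k
    where
    Δℕ : ∣ b ∣ ℕ.* ∣ b ∣ ℕ.+ D ≡ 4 ℕ.* a ℕ.* C
    Δℕ = ℤₚ.+-injective (begin
      + (∣ b ∣ ℕ.* ∣ b ∣ ℕ.+ D)   ≡⟨ ℤₚ.pos-+ (∣ b ∣ ℕ.* ∣ b ∣) D ⟩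
      + (∣ b ∣ ℕ.* ∣ b ∣) + + D   ≡⟨ cong (_+ + D) (i*i≡∣i∣*∣i∣ b) ⟨
      b * b + + D                 ≡⟨ Δ ⟩
      + 4 * + a * + C             ≡⟨ cong (_* + C) (ℤₚ.pos-* 4 a) ⟨
      + (4 ℕ.* a) * + C           ≡⟨ ℤₚ.pos-* (4 ℕ.* a) C ⟨
      + (4 ℕ.* a ℕ.* C)           ∎)
      where open ≡-Reasoning
    C≤B²+D : C < suc (∣ b ∣ ℕ.* ∣ b ∣ ℕ.+ D)
    C≤B²+D = s≤s (ℕₚ.≤-trans (ℕₚ.m≤n*m C (4 ℕ.* a) {{ℕ.>-nonZero (ℕₚ.*-mono-≤ {1} {4} (s≤s z≤n) 1≤a)}})
                              (ℕₚ.≤-reflexive (sym Δℕ)))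
    a≡1×∣b∣≡E : a ≡ 1 × ∣ b ∣ ≡ E
    a≡1×∣b∣≡E = classNumberOne (reduced⇒a<8 D a ∣ b ∣ C D<192 ∣b∣≤a a≤C Δℕ) (s≤s ∣b∣≤a) C≤B²+D 1≤a a≤C Δℕ

  form⇒norm : ∀ a b c → HasDisc (suc a) b c → Represents (suc a) b c → ∃₂ λ m n → norm (+ E) (+ C₀) m n ≡ k
  form⇒norm a b c Δ rep = reduced⇒norm (reduce (suc a) a b c ℕₚ.≤-refl Δ rep)

odd-shift-square : ∀ E C D → 4 ℕ.* C ≡ E ℕ.* E ℕ.+ D → ∀ x J → let b = x + (+ 1 + + 2 * J) * (+ E - x) ; κ = J * (+ E - x) in
                   b * b + + D ≡ + 4 * (κ * κ + κ * + E + + C)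
odd-shift-square E C D 4C≡E²+D x J = begin
  b * b + + D                               ≡⟨ complete x (+ E) J (+ D) ⟩
  + 4 * (κ * κ + κ * + E) + (+ E * + E + + D) ≡⟨ cong (_+_ (+ 4 * (κ * κ + κ * + E))) e²+D≡4C ⟩
  + 4 * (κ * κ + κ * + E) + + 4 * + C         ≡⟨ ℤₚ.*-distribˡ-+ (+ 4) (κ * κ + κ * + E) (+ C) ⟨
  + 4 * (κ * κ + κ * + E + + C)               ∎
  where
  open ≡-Reasoning
  b = x + (+ 1 + + 2 * J) * (+ E - x)
  κ = J * (+ E - x)
  complete : ∀ x e J D → let κ = J * (e - x) in
    (x + (+ 1 + + 2 * J) * (e - x)) * (x + (+ 1 + + 2 * J) * (e - x)) + D ≡ + 4 * (κ * κ + κ * e) + (e * e + D)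
  complete = solve-∀
  e²+D≡4C : + E * + E + + D ≡ + 4 * + C
  e²+D≡4C = trans (cong (_+ + D) (sym (ℤₚ.pos-* E E)))
              (trans (sym (ℤₚ.pos-+ (E ℕ.* E) D)) (trans (cong +_ (sym 4C≡E²+D)) (ℤₚ.pos-* 4 C)))

-- b ≡ x (mod p) and b ≡ e (mod 2), so that 4p ∣ b² + D.
sqrt-mod-p⇒form : ∀ {p} → Prime p → p ≢ 2 → ∀ E C D → 4 ℕ.* C ≡ E ℕ.* E ℕ.+ D → ∀ x →
                  (+ p) ℤˢ.∣ (x * x + + D) → ∃₂ λ b c → b * b + + D ≡ + 4 * + p * c
sqrt-mod-p⇒form {p} pp p≢2 E C D 4C≡E²+D x (ℤˢ.divides w x²+D≡wp) = b , v , (begin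
  b * b + + D                   ≡⟨ b²+D≡4W ⟩
  + 4 * W                       ≡⟨ cong (+ 4 *_) W≡vp ⟩
  + 4 * (v * + p)               ≡⟨ reorder v (+ p) ⟩
  + 4 * + p * v                 ∎)
  where
  open ≡-Reasoning
  e = + E
  j = proj₁ (prime≢2⇒odd pp p≢2)
  p≡1+2j : + p ≡ + 1 + + 2 * + j
  p≡1+2j = trans (cong +_ (proj₂ (prime≢2⇒odd pp p≢2)))
             (trans (ℤₚ.pos-+ 1 (j ℕ.+ j)) (cong (_+_ (+ 1)) (trans (ℤₚ.pos-+ j j) (double (+ j)))))
    where
    double : ∀ i → i + i ≡ + 2 * i
    double = solve-∀
  b = x + + p * (e - x)
  κ = + j * (e - x)
  W = κ * κ + κ * e + + C
  b²+D≡4W : b * b + + D ≡ + 4 * W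
  b²+D≡4W = trans (cong (λ P → (x + P * (e - x)) * (x + P * (e - x)) + + D) p≡1+2j)
                  (odd-shift-square E C D 4C≡E²+D x (+ j))
  b²+D≡up : b * b + + D ≡ (w + (e - x) * (+ 2 * x + + p * (e - x))) * + p
  b²+D≡up = begin
    b * b + + D                                               ≡⟨ expand x (+ p) e (+ D) ⟩
    (x * x + + D) + (e - x) * (+ 2 * x + + p * (e - x)) * + p ≡⟨ cong (_+ (e - x) * (+ 2 * x + + p * (e - x)) * + p) x²+D≡wp ⟩
    w * + p + (e - x) * (+ 2 * x + + p * (e - x)) * + p       ≡⟨ ℤₚ.*-distribʳ-+ (+ p) w _ ⟨
    (w + (e - x) * (+ 2 * x + + p * (e - x))) * + p           ∎
    where
    expand : ∀ x P e D → (x + P * (e - x)) * (x + P * (e - x)) + D ≡ (x * x + D) + (e - x) * (+ 2 * x + P * (e - x)) * P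
    expand = solve-∀
  p∣4W : p ∣ 4 ℕ.* ∣ W ∣
  p∣4W = subst (p ∣_) (ℤₚ.abs-* (+ 4) W)
           (ℤˢ.∣⇒∣ᵤ (ℤˢ.divides (w + (e - x) * (+ 2 * x + + p * (e - x))) (trans (sym b²+D≡4W) b²+D≡up)))
  p∣W : (+ p) ℤˢ.∣ W
  p∣W = [ (λ p∣4 → ⊥-elim (p≢2 (prime∣4⇒≡2 pp p∣4))) , ℤˢ.∣ᵤ⇒∣ ]′ (euclidsLemma 4 ∣ W ∣ pp p∣4W)
  v = ℤˢ.quotient p∣W
  W≡vp : W ≡ v * + p
  W≡vp = ℤˢ._∣_.equality p∣W
  reorder : ∀ v p → + 4 * (v * p) ≡ + 4 * p * v
  reorder = solve-∀

prime-represented : ∀ E C D → 4 ℕ.* C ≡ E ℕ.* E ℕ.+ D → 1 ≤ D → D < 192 → ClassNumberOne D E →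
                    ∀ {p} → Prime p → p ≢ 2 → ∀ x → (+ p) ℤˢ.∣ (x * x + + D) → ∃₂ λ m n → norm (+ E) (+ C) m n ≡ + p
prime-represented E C D 4C≡E²+D 1≤D D<192 classNumberOne {zero} pp = ⊥-elim (¬prime[0] pp)
prime-represented E C D 4C≡E²+D 1≤D D<192 classNumberOne {suc a} pp p≢2 x p∣x²+D =
  let b , c , Δ = sqrt-mod-p⇒form pp p≢2 E C D 4C≡E²+D x p∣x²+D
  in PrincipalForm.form⇒norm E C D 4C≡E²+D 1≤D D<192 classNumberOne (+ suc a) a b c Δ
       (+ 1 , + 0 , value-at-[1,0] (+ suc a) b c)
  where
  value-at-[1,0] : ∀ a b c → binaryForm a b c (+ 1) (+ 0) ≡ a
  value-at-[1,0] = solve-∀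

sumℚ-↭ : ∀ {xs ys} → xs ↭ ys → sumℚ xs ≡ sumℚ ys
sumℚ-↭ xs↭ys = foldr-commMonoid ℚₚ.+-0-isCommutativeMonoid (↭⇒↭ₛ xs↭ys)

filter-↭ : ∀ {A : Set} {P : A → Set} (P? : Decidable P) {xs ys} → Unique xs → Unique ys →
           (∀ {v} → v ∈ ys → v ∈ xs) → (∀ {v} → P v → v ∈ ys) → (∀ {v} → v ∈ ys → P v) → filter P? xs ↭ ys
filter-↭ P? {xs} uxs uys ys⊆xs P⊆ys ys⊆P = ∼bag⇒↭ (unique∧set⇒bag (Unique.filter⁺ P? uxs) uys
  (mk⇔ (λ v∈ → P⊆ys (proj₂ (∈-filter⁻ P? {xs = xs} v∈))) (λ v∈ → ∈-filter⁺ P? (ys⊆xs v∈) (ys⊆P v∈))))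

box≡cartesianProduct : ∀ N → box N ≡ cartesianProduct (symRange N) (symRange N)
box≡cartesianProduct N = go (symRange N)
  where
  go : ∀ xs → concatMap (λ m → map (λ n → (m , n)) (symRange N)) xs ≡ cartesianProduct xs (symRange N)
  go []       = refl
  go (x ∷ xs) = cong (map (λ n → (x , n)) (symRange N) ++_) (go xs)

symRange-unique : ∀ N → Unique (symRange N)
symRange-unique N = Unique.map⁺ shift-injective (Unique.upTo⁺ (suc (N ℕ.+ N)))
  where
  unshift : ∀ i n → i - n + n ≡ i
  unshift = solve-∀
  shift-injective : ∀ {i j} → + i - + N ≡ + j - + N → i ≡ j
  shift-injective {i} {j} eq =
    ℤₚ.+-injective (trans (sym (unshift (+ i) (+ N))) (trans (cong (_+ + N) eq) (unshift (+ j) (+ N))))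

box-unique : ∀ N → Unique (box N)
box-unique N = subst Unique (sym (box≡cartesianProduct N))
                 (Unique.cartesianProduct⁺ (symRange-unique N) (symRange-unique N))

∈-symRange : ∀ N i → ∣ i ∣ ≤ N → i ∈ symRange N
∈-symRange N (+ u) u≤N =
  subst (_∈ symRange N) shifted (∈-map⁺ (λ j → + j - + N) (∈-upTo⁺ (s≤s (ℕₚ.+-monoˡ-≤ N u≤N))))
  where
  cancel : ∀ u n → u + n - n ≡ u
  cancel = solve-∀
  shifted : + (u ℕ.+ N) - + N ≡ + u
  shifted = trans (cong (_- + N) (ℤₚ.pos-+ u N)) (cancel (+ u) (+ N))
∈-symRange N -[1+ u ] 1+u≤N =
  subst (_∈ symRange N) shifted (∈-map⁺ (λ j → + j - + N) (∈-upTo⁺ (s≤s r≤2N)))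
  where
  r = N ℕ.∸ suc u
  cancel : ∀ r u → r - (+ 1 + u + r) ≡ - (+ 1 + u)
  cancel = solve-∀
  shifted : + r - + N ≡ -[1+ u ]
  shifted = begin
    + r - + N                ≡⟨ cong (λ n → + r - + n) (ℕₚ.m+[n∸m]≡n 1+u≤N) ⟨
    + r - + (suc u ℕ.+ r)    ≡⟨ cong (λ i → + r - i) (trans (ℤₚ.pos-+ (suc u) r) (cong (_+ + r) (ℤₚ.pos-+ 1 u))) ⟩
    + r - (+ 1 + + u + + r)  ≡⟨ cancel (+ r) (+ u) ⟩
    -[1+ u ]                 ∎
    where open ≡-Reasoning
  r≤2N : r ≤ N ℕ.+ N
  r≤2N = ℕₚ.≤-trans (ℕₚ.m∸n≤m N (suc u)) (ℕₚ.m≤m+n N N)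

∈-box : ∀ N m n → ∣ m ∣ ≤ N → ∣ n ∣ ≤ N → (m , n) ∈ box N
∈-box N m n ∣m∣≤N ∣n∣≤N = subst ((m , n) ∈_) (sym (box≡cartesianProduct N))
  (∈-cartesianProduct⁺ (∈-symRange N m ∣m∣≤N) (∈-symRange N n ∣n∣≤N))

sum4 : ℚ → ℚ
sum4 q = q ℚ.+ (q ℚ.+ (q ℚ.+ (q ℚ.+ 0ℚ)))

sum4≡4* : ∀ q → sum4 q ≡ (+ 4 / 1) ℚ.* q
sum4≡4* = solve 1 (λ q → q :+ (q :+ (q :+ (q :+ con 0ℚ))) := con (+ 4 / 1) :* q) refl
  where open +-*-Solver

sum4[i/n]≡j/1⇒4i≡j*n : ∀ i k j → sum4 (i / suc k) ≡ j / 1 → + 4 * i ≡ j * + suc k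
sum4[i/n]≡j/1⇒4i≡j*n i k j eq = trans (sym (ℤₚ.*-identityʳ (+ 4 * i)))
  (trans (ℚᵘₚ.drop-*≡* 4i/n≃j) (cong (λ n → j * + n) (ℕₚ.+-identityʳ (suc k))))
  where
  toℚᵘ-4i/n : ℚ.toℚᵘ ((+ 4 / 1) ℚ.* (i / suc k)) ℚᵘ.≃ mkℚᵘ (+ 4) 0 ℚᵘ.* mkℚᵘ i k
  toℚᵘ-4i/n = ℚᵘₚ.≃-trans (ℚₚ.toℚᵘ-homo-* (+ 4 / 1) (i / suc k))
                (ℚᵘₚ.*-congˡ {mkℚᵘ (+ 4) 0} (ℚₚ.toℚᵘ-fromℚᵘ (mkℚᵘ i k)))
  4i/n≃j : mkℚᵘ (+ 4) 0 ℚᵘ.* mkℚᵘ i k ℚᵘ.≃ mkℚᵘ j 0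
  4i/n≃j = ℚᵘₚ.≃-trans (ℚᵘₚ.≃-sym toℚᵘ-4i/n)
             (ℚᵘₚ.≃-trans (ℚₚ.toℚᵘ-cong (trans (sym (sum4≡4* (i / suc k))) eq)) (ℚₚ.toℚᵘ-fromℚᵘ (mkℚᵘ j 0)))

module Coefficient {p D : ℕ} (pp : Prime p) (p≢2 : p ≢ 2) (5≤D : 5 ≤ D) (X n : ℤ)
                   (X²+Dn²≡4p : X * X + + D * (n * n) ≡ + 4 * + p) where

  b : ℚ
  b = sum4 ((X * X - + D * (n * n)) / 8)

  b≡T/1⇒X²≡T+2p : ∀ T → b ≡ T / 1 → X * X ≡ T + + 2 * + p
  b≡T/1⇒X²≡T+2p T b≡T = ℤₚ.*-cancelˡ-≡ (+ 8) (X * X) (T + + 2 * + p) (begin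
    + 8 * (X * X)                                                  ≡⟨ split X (n * n) (+ D) ⟩
    + 4 * (X * X - + D * (n * n)) + + 4 * (X * X + + D * (n * n))  ≡⟨ cong₂ (λ x y → x + + 4 * y) 4Z≡8T X²+Dn²≡4p ⟩
    T * + 8 + + 4 * (+ 4 * + p)                                    ≡⟨ collect T (+ p) ⟩
    + 8 * (T + + 2 * + p)                                          ∎)
    where
    open ≡-Reasoning
    4Z≡8T = sum4[i/n]≡j/1⇒4i≡j*n (X * X - + D * (n * n)) 7 T b≡T
    split : ∀ X N D → + 8 * (X * X) ≡ + 4 * (X * X - D * N) + + 4 * (X * X + D * N)
    split = solve-∀
    collect : ∀ T p → T * + 8 + + 4 * (+ 4 * p) ≡ + 8 * (T + + 2 * p)
    collect = solve-∀

  b≢0 : b ≢ 0ℚ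
  b≢0 b≡0 = p≢2 (prime∣irreducible⇒≡ pp irreducible[2] (i*i≡+k*+p⇒p∣k pp X 2
              (trans (b≡T/1⇒X²≡T+2p (+ 0) b≡0) (ℤₚ.+-identityˡ (+ 2 * + p)))))

  b≢-p : b ≢ - + p / 1
  b≢-p b≡-p = prime∤1 pp (i*i≡+k*+p⇒p∣k pp X 1 (trans (b≡T/1⇒X²≡T+2p (- + p) b≡-p) (collect (+ p))))
    where
    collect : ∀ p → - p + + 2 * p ≡ + 1 * p
    collect = solve-∀

  b≢p : b ≢ + p / 1
  b≢p b≡p = 5≤D⇒D*n²≢3 ∣ n ∣ 5≤D (ℤₚ.+-injective (begin
    + (D ℕ.* (∣ n ∣ ℕ.* ∣ n ∣))       ≡⟨ ℤₚ.pos-* D _ ⟩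
    + D * + (∣ n ∣ ℕ.* ∣ n ∣)         ≡⟨ cong (+ D *_) (i*i≡∣i∣*∣i∣ n) ⟨
    + D * (n * n)                     ≡⟨ difference (X * X) (+ D * (n * n)) ⟩
    (X * X + + D * (n * n)) - X * X   ≡⟨ cong₂ _-_ X²+Dn²≡4p X²≡3p ⟩
    + 4 * + p - + 3 * + p             ≡⟨ collect (+ p) ⟩
    + p                               ≡⟨ cong +_ (prime∣3⇒≡3 pp (i*i≡+k*+p⇒p∣k pp X 3 X²≡3p)) ⟩
    + 3                               ∎))
    where
    open ≡-Reasoning
    triple : ∀ p → p + + 2 * p ≡ + 3 * p
    triple = solve-∀
    X²≡3p : X * X ≡ + 3 * + p
    X²≡3p = trans (b≡T/1⇒X²≡T+2p (+ p) b≡p) (triple (+ p))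
    difference : ∀ a b → b ≡ (a + b) - a
    difference = solve-∀
    collect : ∀ p → + 4 * p - + 3 * p ≡ p
    collect = solve-∀

-- O_K = ℤ[ω] with ω² - E ω + C = 0, and D = ∣d_K∣.
record RingOfIntegers (d : ℕ) : Set where
  field
    E C D          : ℕ
    4C≡E²+D        : 4 ℕ.* C ≡ E ℕ.* E ℕ.+ D
    E≤1            : E ≤ 1
    5≤D            : 5 ≤ D
    D<192          : D < 192
    classNumberOne : ClassNumberOne D E
    disc≡-D        : disc d ≡ - + D
    innerSq≡norm   : ∀ m n → innerSq d m n ≡ norm (+ E) (+ C) m n
    P1≡            : ∀ m n → P1 d m n ≡ ((+ 2 * m + + E * n) * (+ 2 * m + + E * n) - + D * (n * n)) / 8

module _ {d : ℕ} (𝒪 : RingOfIntegers d) where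
  open RingOfIntegers 𝒪
  open NormForm E C D 4C≡E²+D

  P1-orbit-sum : ∀ m n → sumℚ (map (uncurry (P1 d)) (orbit (m , n))) ≡ sum4 (P1 d m n)
  P1-orbit-sum m n = cong (P1 d m n ℚ.+_)
    (cong₂ ℚ._+_ (P1-neg m n) (cong₂ ℚ._+_ P1-conj (cong (ℚ._+ 0ℚ) (trans (P1-neg (m + e * n) (- n)) P1-conj))))
    where
    Z-neg : ∀ e D m n → (+ 2 * (- m) + e * (- n)) * (+ 2 * (- m) + e * (- n)) - D * ((- n) * (- n))
                        ≡ (+ 2 * m + e * n) * (+ 2 * m + e * n) - D * (n * n)
    Z-neg = solve-∀
    Z-conj : ∀ e D m n → (+ 2 * (m + e * n) + e * (- n)) * (+ 2 * (m + e * n) + e * (- n)) - D * ((- n) * (- n))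
                         ≡ (+ 2 * m + e * n) * (+ 2 * m + e * n) - D * (n * n)
    Z-conj = solve-∀
    P1-neg : ∀ m n → P1 d (- m) (- n) ≡ P1 d m n
    P1-neg m n = trans (P1≡ (- m) (- n)) (trans (cong (_/ 8) (Z-neg e (+ D) m n)) (sym (P1≡ m n)))
    P1-conj : P1 d (m + e * n) (- n) ≡ P1 d m n
    P1-conj = trans (P1≡ _ _) (trans (cong (_/ 8) (Z-conj e (+ D) m n)) (sym (P1≡ m n)))

  theta≡sum4 : ∀ {p} → Prime p → p ≢ 2 → ¬ p ∣ D → ∀ m n → N m n ≡ + p → thetaCoeff d p ≡ sum4 (P1 d m n)
  theta≡sum4 {p} pp p≢2 p∤D m n N≡p =
    trans (sumℚ-↭ (↭.map⁺ (uncurry (P1 d))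
            (filter-↭ P? (box-unique p) (orbit-unique pp p≢2 p∤D m n N≡p) orbit⊆box represents⇒∈orbit ∈orbit⇒represents)))
          (P1-orbit-sum m n)
    where
    P? = λ { (m , n) → innerSq d m n ℤ.≟ + p }
    N≡p-on : ∀ {u} → u ∈ orbit (m , n) → uncurry N u ≡ + p
    N≡p-on u∈ = trans (∈orbit⇒norm≡ u∈) N≡p
    orbit⊆box : ∀ {u} → u ∈ orbit (m , n) → u ∈ box p
    orbit⊆box {u₁ , u₂} u∈ =
      ∈-box p u₁ u₂ (norm≡p⇒∣m∣≤p pp 5≤D E≤1 u₁ u₂ (N≡p-on u∈)) (norm≡p⇒∣n∣≤p pp 5≤D u₁ u₂ (N≡p-on u∈))
    represents⇒∈orbit : ∀ {u} → innerSq d (proj₁ u) (proj₂ u) ≡ + p → u ∈ orbit (m , n)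
    represents⇒∈orbit {u₁ , u₂} rep = norm≡p⇒∈orbit pp 5≤D m n u₁ u₂ N≡p (trans (sym (innerSq≡norm u₁ u₂)) rep)
    ∈orbit⇒represents : ∀ {u} → u ∈ orbit (m , n) → innerSq d (proj₁ u) (proj₂ u) ≡ + p
    ∈orbit⇒represents {u₁ , u₂} u∈ = trans (innerSq≡norm u₁ u₂) (N≡p-on u∈)

  coefficient-at-odd-prime : ∀ {p} → Prime p → p ≢ 2 → ¬ p ∣ D → ∀ x → (+ p) ℤˢ.∣ (x * x + + D) →
    (thetaCoeff d p ≢ 0ℚ) × (thetaCoeff d p ≢ (+ p) / 1) × (thetaCoeff d p ≢ (- (+ p)) / 1)
  coefficient-at-odd-prime {p} pp p≢2 p∤D x p∣x²+D = b≢0 ∘ b≡ , b≢p ∘ b≡ , b≢-p ∘ b≡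
    where
    representation = prime-represented E C D 4C≡E²+D (ℕₚ.≤-trans (s≤s z≤n) 5≤D) D<192 classNumberOne pp p≢2 x p∣x²+D
    m = proj₁ representation
    n = proj₁ (proj₂ representation)
    N≡p = proj₂ (proj₂ representation)
    open Coefficient pp p≢2 5≤D (+ 2 * m + e * n) n (trans (X²+Dn²≡4N m n) (cong (+ 4 *_) N≡p))
    b≡ : ∀ {q} → thetaCoeff d p ≡ q → b ≡ q
    b≡ θ≡q = trans (sym (trans (theta≡sum4 pp p≢2 p∤D m n N≡p) (cong sum4 (P1≡ m n)))) θ≡q

  coefficient-at-prime≥3 : ∀ k → let p = 3 ℕ.+ k in Prime p → KroneckerOne (disc d) p →
    (thetaCoeff d p ≢ 0ℚ) × (p ≢ d → (thetaCoeff d p ≢ (+ p) / 1) × (thetaCoeff d p ≢ (- (+ p)) / 1))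
  coefficient-at-prime≥3 k pp (p∤dK , x , p∣x²-dK) = b≢0 , λ _ → b≢±p
    where
    ∣dK∣≡D : ∣ disc d ∣ ≡ D
    ∣dK∣≡D = trans (cong ∣_∣ disc≡-D) (ℤₚ.∣-i∣≡∣i∣ (+ D))
    x²-dK≡x²+D : x * x - disc d ≡ x * x + + D
    x²-dK≡x²+D = trans (cong (λ z → x * x - z) disc≡-D) (cong (_+_ (x * x)) (ℤₚ.neg-involutive (+ D)))
    values = coefficient-at-odd-prime pp (λ ()) (p∤dK ∘ subst (3 ℕ.+ k ∣_) (sym ∣dK∣≡D)) x
               (ℤˢ.∣ᵤ⇒∣ (subst (+ (3 ℕ.+ k) ℤᵘ.∣_) x²-dK≡x²+D p∣x²-dK))
    b≢0 = proj₁ values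
    b≢±p = proj₂ values

oddRingOfIntegers : ∀ d C → 4 ℕ.* C ≡ 1 ℕ.+ d → 5 ≤ d → d < 192 → ClassNumberOne d 1 → disc d ≡ - + d →
           (∀ m n → innerSq d m n ≡ m * m + m * n + + C * (n * n)) →
           (∀ m n → P1 d m n ≡ ((+ 2 * m + n) * (+ 2 * m + n) - + d * (n * n)) / 8) → RingOfIntegers d
oddRingOfIntegers d C 4C≡1+d 5≤d d<192 classNumberOne disc≡-d innerSq≡ P1≡ = record
  { E = 1 ; C = C ; D = d ; 4C≡E²+D = 4C≡1+d ; E≤1 = ℕₚ.≤-refl ; 5≤D = 5≤d ; D<192 = d<192
  ; classNumberOne = classNumberOne ; disc≡-D = disc≡-d
  ; innerSq≡norm = λ m n → trans (innerSq≡ m n) (unit-e (+ C) m n)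
  ; P1≡ = λ m n → trans (P1≡ m n) (cong (_/ 8) (unit-X (+ d) m n)) }
  where
  unit-e : ∀ c m n → m * m + m * n + c * (n * n) ≡ norm (+ 1) c m n
  unit-e = solve-∀
  unit-X : ∀ D m n → (+ 2 * m + n) * (+ 2 * m + n) - D * (n * n) ≡ (+ 2 * m + + 1 * n) * (+ 2 * m + + 1 * n) - D * (n * n)
  unit-X = solve-∀

ℤ[√-2] : RingOfIntegers 2
ℤ[√-2] = record
  { E = 0 ; C = 2 ; D = 8 ; 4C≡E²+D = refl ; E≤1 = z≤n ; 5≤D = from-yes (5 ≤? 8) ; D<192 = from-yes (8 <? 192)
  ; classNumberOne = from-yes (classNumberOne? 8 0) ; disc≡-D = refl
  ; innerSq≡norm = norm-form
  ; P1≡ = λ m n → ℚₚ.fromℚᵘ-cong {mkℚᵘ (m * m - + 2 * (n * n)) 1}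
                    {mkℚᵘ ((+ 2 * m + + 0 * n) * (+ 2 * m + + 0 * n) - + 8 * (n * n)) 7} (*≡* (rescale m n)) }
  where
  norm-form : ∀ m n → m * m + + 2 * (n * n) ≡ norm (+ 0) (+ 2) m n
  norm-form = solve-∀
  rescale : ∀ m n → (m * m - + 2 * (n * n)) * + 8 ≡ ((+ 2 * m + + 0 * n) * (+ 2 * m + + 0 * n) - + 8 * (n * n)) * + 2
  rescale = solve-∀

ringOfIntegers : ∀ {d} → d ∈ admissibleD → RingOfIntegers d
ringOfIntegers (here refl) = ℤ[√-2]
ringOfIntegers (there (here refl)) =
  oddRingOfIntegers 7 2 refl (from-yes (5 ≤? 7)) (from-yes (7 <? 192)) (from-yes (classNumberOne? 7 1)) refl (λ _ _ → refl) (λ _ _ → refl)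
ringOfIntegers (there (there (here refl))) =
  oddRingOfIntegers 11 3 refl (from-yes (5 ≤? 11)) (from-yes (11 <? 192)) (from-yes (classNumberOne? 11 1)) refl (λ _ _ → refl) (λ _ _ → refl)
ringOfIntegers (there (there (there (here refl)))) =
  oddRingOfIntegers 19 5 refl (from-yes (5 ≤? 19)) (from-yes (19 <? 192)) (from-yes (classNumberOne? 19 1)) refl (λ _ _ → refl) (λ _ _ → refl)
ringOfIntegers (there (there (there (there (here refl))))) =
  oddRingOfIntegers 43 11 refl (from-yes (5 ≤? 43)) (from-yes (43 <? 192)) (from-yes (classNumberOne? 43 1)) refl (λ _ _ → refl) (λ _ _ → refl)
ringOfIntegers (there (there (there (there (there (here refl)))))) =
  oddRingOfIntegers 67 17 refl (from-yes (5 ≤? 67)) (from-yes (67 <? 192)) (from-yes (classNumberOne? 67 1)) refl (λ _ _ → refl) (λ _ _ → refl)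
ringOfIntegers (there (there (there (there (there (there (here refl))))))) =
  oddRingOfIntegers 163 41 refl (from-yes (5 ≤? 163)) (from-yes (163 <? 192)) (from-yes (classNumberOne? 163 1)) refl (λ _ _ → refl) (λ _ _ → refl)

-- KroneckerOne (disc d) 2 says 8 ∣ ∣d_K - 1∣; it holds only for d = 7, where thetaCoeff 7 2 = -3.
coefficient-at-2 : ∀ {d} → d ∈ admissibleD → KroneckerOne (disc d) 2 →
  (thetaCoeff d 2 ≢ 0ℚ) × (2 ≢ d → (thetaCoeff d 2 ≢ (+ 2) / 1) × (thetaCoeff d 2 ≢ (- (+ 2)) / 1))
coefficient-at-2 (here refl) 8∣9 = ⊥-elim (from-no (8 ∣? 9) 8∣9)
coefficient-at-2 (there (here refl)) _ = (λ ()) , λ _ → (λ ()) , (λ ())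
coefficient-at-2 (there (there (here refl))) 8∣12 = ⊥-elim (from-no (8 ∣? 12) 8∣12)
coefficient-at-2 (there (there (there (here refl)))) 8∣20 = ⊥-elim (from-no (8 ∣? 20) 8∣20)
coefficient-at-2 (there (there (there (there (here refl))))) 8∣44 = ⊥-elim (from-no (8 ∣? 44) 8∣44)
coefficient-at-2 (there (there (there (there (there (here refl)))))) 8∣68 = ⊥-elim (from-no (8 ∣? 68) 8∣68)
coefficient-at-2 (there (there (there (there (there (there (here refl))))))) 8∣164 = ⊥-elim (from-no (8 ∣? 164) 8∣164)

lemma4p2 : (d : ℕ) → d ∈ admissibleD → (p : ℕ) → Prime p → KroneckerOne (disc d) p →
    (thetaCoeff d p ≢ 0ℚ)
    × (p ≢ d → (thetaCoeff d p ≢ (+ p) / 1) × (thetaCoeff d p ≢ (- (+ p)) / 1))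
lemma4p2 d d∈ 0 pp = ⊥-elim (¬prime[0] pp)
lemma4p2 d d∈ 1 pp = ⊥-elim (¬prime[1] pp)
lemma4p2 d d∈ 2 _ = coefficient-at-2 d∈
lemma4p2 d d∈ (suc (suc (suc k))) = coefficient-at-prime≥3 (ringOfIntegers d∈) k
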